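{- For any derivation of a sequent $S \mid \Gamma \vdash C$ in the skew monoidal sequent calculus, there is a derivation $\llbracket S \mid \Gamma \rrbracket \Rightarrow C$ in the skew monoidal categorical calculus. In particular, for any derivation of $A \mid\ \vdash C$ there is a derivation $A \Rightarrow C$.
   Context: Fix a set $\mathrm{Var}$ of atoms. Formulae are generated by: every atom $X \in \mathrm{Var}$ is a formula; $\mathsf{I}$ is a formula; if $A, B$ are formulae then so is $A \otimes B$. A context $\Gamma$ is a finite list of formulae; a stoup $S$ is either empty (written $-$) or a single formula. The skew monoidal categorical calculus derives judgements $A \Rightarrow C$ by the rules: $\mathrm{id}_A : A \Rightarrow A$; from $f : A \Rightarrow B$ and $g : B \Rightarrow C$ infer $g \circ f : A \Rightarrow C$; from $f : A \Rightarrow C$ and $g : B \Rightarrow D$ infer $f \otimes g : A \otimes B \Rightarrow C \otimes D$; axioms $\lambda_A : \mathsf{I} \otimes A \Rightarrow A$, $\rho_A : A \Rightarrow A \otimes \mathsf{I}$, $\alpha_{A,B,C} : (A \otimes B) \otimes C \Rightarrow A \otimes (B \otimes C)$. The skew monoidal sequent calculus derives sequents $S \mid \Gamma \vdash C$ by the rules: (ax) $A \mid\ \vdash A$; (pass) from $A \mid \Gamma \vdash C$ infer $- \mid A, \Gamma \vdash C$; (scut) from $S \mid \Gamma \vdash A$ and $A \mid \Delta \vdash C$ infer $S \mid \Gamma, \Delta \vdash C$; (ccut) from $- \mid \Gamma \vdash A$ and $S \mid \Delta_0, A, \Delta_1 \vdash C$ infer $S \mid \Delta_0, \Gamma, \Delta_1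 \vdash C$; ($\mathsf{I}$L) from $- \mid \Gamma \vdash C$ infer $\mathsf{I} \mid \Gamma \vdash C$; ($\mathsf{I}$R) $- \mid\ \vdash \mathsf{I}$; ($\otimes$L) from $A \mid B, \Gamma \vdash C$ infer $A \otimes B \mid \Gamma \vdash C$; ($\otimes$R) from $S \mid \Gamma \vdash A$ and $- \mid \Delta \vdash B$ infer $S \mid \Gamma, \Delta \vdash A \otimes B$. Interpretation of antecedents: $\llbracket - \rrbracket = \mathsf{I}$, $\llbracket A \rrbracket = A$; $C \triangleleft () = C$, $C \triangleleft (A, \Gamma) = (C \otimes A) \triangleleft \Gamma$; $\llbracket S \mid \Gamma \rrbracket = \llbracket S \rrbracket \triangleleft \Gamma$, i.e. $\llbracket S \mid A_1,\dots,A_n\rrbracket = (\cdots(\llbracket S\rrbracket \otimes A_1)\cdots)\otimes A_n$. -}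

module Defs where

open import Data.List using (List; []; _∷_; _++_)
open import Data.Maybe using (Maybe; nothing; just)

data Fma (Var : Set) : Set where
  ` : Var → Fma Var
  I : Fma Var
  _⊗_ : Fma Var → Fma Var → Fma Var

infixl 6 _⊗_

module _ {Var : Set} where

  Stp : Set
  Stp = Maybe (Fma Var)

  Cxt : Set
  Cxt = List (Fma Var)

  infix 4 _⇒_
  data _⇒_ : Fma Var → Fma Var → Set where
    id  : {A : Fma Var} → A ⇒ A
    _∘_ : {A B C : Fma Var} → B ⇒ C → A ⇒ B → A ⇒ C
    _⊗'_ : {A B C D : Fma Var} → A ⇒ C → B ⇒ D → A ⊗ B ⇒ C ⊗ D
    λ'  : {A : Fma Var} → I ⊗ A ⇒ A
    ρ'  : {A : Fma Var} → A ⇒ A ⊗ I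
    α'  : {A B C : Fma Var} → (A ⊗ B) ⊗ C ⇒ A ⊗ (B ⊗ C)

  infix 4 _∣_⊢_
  data _∣_⊢_ : Stp → Cxt → Fma Var → Set where
    ax   : {A : Fma Var} → just A ∣ [] ⊢ A
    pass : {Γ : Cxt} {A C : Fma Var} → just A ∣ Γ ⊢ C → nothing ∣ A ∷ Γ ⊢ C
    scut : {S : Stp} {Γ Δ : Cxt} {A C : Fma Var} →
           S ∣ Γ ⊢ A → just A ∣ Δ ⊢ C → S ∣ Γ ++ Δ ⊢ C
    ccut : {S : Stp} {Γ Δ₀ Δ₁ : Cxt} {A C : Fma Var} →
           nothing ∣ Γ ⊢ A → S ∣ Δ₀ ++ A ∷ Δ₁ ⊢ C → S ∣ Δ₀ ++ Γ ++ Δ₁ ⊢ C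
    IL   : {Γ : Cxt} {C : Fma Var} → nothing ∣ Γ ⊢ C → just I ∣ Γ ⊢ C
    IR   : nothing ∣ [] ⊢ I
    ⊗L   : {Γ : Cxt} {A B C : Fma Var} → just A ∣ B ∷ Γ ⊢ C → just (A ⊗ B) ∣ Γ ⊢ C
    ⊗R   : {S : Stp} {Γ Δ : Cxt} {A B : Fma Var} →
           S ∣ Γ ⊢ A → nothing ∣ Δ ⊢ B → S ∣ Γ ++ Δ ⊢ A ⊗ B

  ⟦_⟧s : Stp → Fma Var
  ⟦ nothing ⟧s = I
  ⟦ just A ⟧s = A

  _◁_ : Fma Var → Cxt → Fma Var
  C ◁ [] = C
  C ◁ (A ∷ Γ) = (C ⊗ A) ◁ Γ

  ⟦_∣_⟧ : Stp → Cxt → Fma Var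
  ⟦ S ∣ Γ ⟧ = ⟦ S ⟧s ◁ Γ

-- The only
-- categorical structure needed is functoriality of _◁ Γ in its first
-- argument and a map  B ◁ Γ ⇒ B ⊗ (I ◁ Γ)  splitting off the head of a
-- left-nested tensor, built from ρ and repeated uses of α; with it the
-- right tensor rule and context cuts interpret the context Γ of a
-- premise  - ∣ Γ ⊢ A  in isolation.
module Submission where

open import Defs
open import Data.List using (List; []; _∷_; _++_)
open import Data.Maybe using (Maybe; just)
open import Data.Product using (_×_; _,_)
open import Relation.Binary.PropositionalEquality using (_≡_; refl)

module _ {Var : Set} where

  ⇒-reflexive : {A B : Fma Var} → A ≡ B → A ⇒ B
  ⇒-reflexive refl = id

  ◁-++ : (A : Fma Var) (Γ Δ : List (Fma Var)) → A ◁ (Γ ++ Δ) ≡ (A ◁ Γ) ◁ Δ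
  ◁-++ A []      Δ = refl
  ◁-++ A (X ∷ Γ) Δ = ◁-++ (A ⊗ X) Γ Δ

  ◁-mono : {A B : Fma Var} (Γ : List (Fma Var)) → A ⇒ B → A ◁ Γ ⇒ B ◁ Γ
  ◁-mono []      f = f
  ◁-mono (X ∷ Γ) f = ◁-mono Γ (f ⊗' id)

  ⊗-◁-assoc : (B D : Fma Var) (Γ : List (Fma Var)) → (B ⊗ D) ◁ Γ ⇒ B ⊗ (D ◁ Γ)
  ⊗-◁-assoc B D []      = id
  ⊗-◁-assoc B D (X ∷ Γ) = ⊗-◁-assoc B (D ⊗ X) Γ ∘ ◁-mono Γ α'

  ◁-split : (B : Fma Var) (Γ : List (Fma Var)) → B ◁ Γ ⇒ B ⊗ (I ◁ Γ)
  ◁-split B Γ = ⊗-◁-assoc B I Γ ∘ ◁-mono Γ ρ'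

  ◁-++-cut : {A C : Fma Var} (Γ Δ : List (Fma Var)) → A ◁ Γ ⇒ C → A ◁ (Γ ++ Δ) ⇒ C ◁ Δ
  ◁-++-cut {A} Γ Δ f = ◁-mono Δ f ∘ ⇒-reflexive (◁-++ A Γ Δ)

  ◁-plug : {A : Fma Var} (B : Fma Var) (Δ₀ Γ Δ₁ : List (Fma Var)) →
           I ◁ Γ ⇒ A → B ◁ (Δ₀ ++ Γ ++ Δ₁) ⇒ B ◁ (Δ₀ ++ A ∷ Δ₁)
  ◁-plug B []       Γ Δ₁ f = ◁-++-cut Γ Δ₁ ((id ⊗' f) ∘ ◁-split B Γ)
  ◁-plug B (X ∷ Δ₀) Γ Δ₁ f = ◁-plug (B ⊗ X) Δ₀ Γ Δ₁ f

  sound : {S : Maybe (Fma Var)} {Γ : List (Fma Var)} {C : Fma Var} →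
          S ∣ Γ ⊢ C → ⟦ S ∣ Γ ⟧ ⇒ C
  sound ax                            = id
  sound (pass {Γ} d)                  = sound d ∘ ◁-mono Γ λ'
  sound (scut {Γ = Γ} {Δ} d e)        = sound e ∘ ◁-++-cut Γ Δ (sound d)
  sound (ccut {S} {Γ} {Δ₀} {Δ₁} d e)  = sound e ∘ ◁-plug ⟦ S ⟧s Δ₀ Γ Δ₁ (sound d)
  sound (IL d)                        = sound d
  sound IR                            = id
  sound (⊗L d)                        = sound d
  sound (⊗R {S} {Γ} {Δ} d e)          =
    (sound d ⊗' sound e) ∘ (◁-split (⟦ S ⟧s ◁ Γ) Δ ∘ ⇒-reflexive (◁-++ ⟦ S ⟧s Γ Δ))

theorem3p7 : {Var : Set} →
             ({S : Maybe (Fma Var)} {Γ : List (Fma Var)} {C : Fma Var} →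
               S ∣ Γ ⊢ C → ⟦ S ∣ Γ ⟧ ⇒ C)
             × ({A C : Fma Var} → just A ∣ [] ⊢ C → A ⇒ C)
theorem3p7 = sound , sound
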